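{- Assume $\Gamma$ has no slices. Then for every mincut $K$ of $\Gamma$ there are at most finitely many mincuts $L$ such that $[K]$ and $[L]$ cross.
   Context: $\Gamma=(V,E)$ is a connected graph. For $K\subseteq V$, $\Gamma-K$ is $\Gamma$ with $K$ and incident edges deleted. A vertex cut is a finite $K\subseteq V$ with $\Gamma-K$ disconnected. A ray is an infinite sequence of distinct vertices with consecutive ones adjacent; rays $r_1,r_2$ are equivalent if for every vertex cut $K$ all but finitely many vertices of $r_1\cup r_2$ lie in one component of $\Gamma-K$; ends are the equivalence classes. An end cut is a vertex cut $K$ such that at least two components of $\Gamma-K$ contain rays; it is assumed end cuts exist, and a mincut is an end cut of minimal cardinality. $\Gamma$ has no slices means: for every mincut $K$, every component of $\Gamma-K$ contains a ray. A mincut $K$ induces a partition $K^{(1)}\sqcup\dots\sqcup K^{(r)}$ of the set of ends according to the component of $\Gamma-K$ containing them; mincuts are equivalent if they induce the same partition, $[K]$ denoting the class; $[K],[L]$ cross if, after relabelling, $K^{(i)}\cap L^{(j)}\neq\emptyset$ for all $i,j\in\{1,2\}$. -}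

module Defs where

open import Level using (0ℓ)
open import Data.Nat using (ℕ; suc; _≤_)
open import Data.List using (List; []; length)
open import Data.List.Membership.Propositional using (_∈_; _∉_)
open import Data.List.Relation.Unary.Unique.Propositional using (Unique)
open import Data.Product using (Σ; ∃; ∃-syntax; _×_; _,_)
open import Relation.Nullary using (¬_)
open import Relation.Binary.PropositionalEquality using (_≡_)
open import Function.Bundles using (_⇔_)
open import Axiom.ExcludedMiddle using (ExcludedMiddle)

record Graph : Set₁ where
  field
    V   : Set
    _~_ : V → V → Set
    ~-sym : ∀ {x y} → x ~ y → y ~ x

module _ (Γ : Graph) where
  open Graph Γ

  -- Finite vertex sets are represented by lists of vertices.
  -- Conn K x y : x and y lie in the same component of Γ - K
  -- (there is a walk from x to y avoiding K).
  data Conn (K : List V) : V → V → Set where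
    here : ∀ {x} → x ∉ K → Conn K x x
    step : ∀ {x y z} → x ∉ K → x ~ y → Conn K y z → Conn K x z

  Connected : Set
  Connected = ∀ x y → Conn [] x y

  VertexCut : List V → Set
  VertexCut K = ∃[ x ] ∃[ y ] (x ∉ K × y ∉ K × ¬ Conn K x y)

  record Ray : Set where
    field
      seq : ℕ → V
      inj : ∀ m n → seq m ≡ seq n → m ≡ n
      adj : ∀ n → seq n ~ seq (suc n)
  open Ray public

  CompHasRay : List V → V → Set
  CompHasRay K x = ∃[ r ] (∀ n → Conn K x (seq r n))

  -- the end of the ray r lies in (the part of the end partition given by)
  -- the component of Γ - K containing x: all but finitely many vertices of r
  -- lie in that component
  EndIn : List V → V → Ray → Set
  EndIn K x r = ∃[ N ] (∀ n → N ≤ n → Conn K x (seq r n))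

  EndCut : List V → Set
  EndCut K = ∃[ x ] ∃[ y ] (¬ Conn K x y × CompHasRay K x × CompHasRay K y)

  -- mincut: end cut of minimal cardinality (lists without repetitions, so
  -- length = cardinality)
  MinCut : List V → Set
  MinCut K = Unique K × EndCut K
           × (∀ L → Unique L → EndCut L → length K ≤ length L)

  NoSlices : Set
  NoSlices = ∀ K → MinCut K → ∀ x → x ∉ K → CompHasRay K x

  -- [K] and [L] cross: there are two distinct components A₁ , A₂ of Γ - K
  -- (represented by x₁ , x₂) and two distinct components B₁ , B₂ of Γ - L
  -- (represented by y₁ , y₂) such that for all i , j ∈ {1,2} some end lies
  -- both in K^(i) (the part of A_i) and in L^(j) (the part of B_j).
  Cross : List V → List V → Set
  Cross K L = ∃[ x₁ ] ∃[ x₂ ] ∃[ y₁ ] ∃[ y₂ ]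
    ( ¬ Conn K x₁ x₂ × ¬ Conn L y₁ y₂
    × (∃[ r ] (EndIn K x₁ r × EndIn L y₁ r))
    × (∃[ r ] (EndIn K x₁ r × EndIn L y₂ r))
    × (∃[ r ] (EndIn K x₂ r × EndIn L y₁ r))
    × (∃[ r ] (EndIn K x₂ r × EndIn L y₂ r)) )

  SameSet : List V → List V → Set
  SameSet L L′ = ∀ v → (v ∈ L ⇔ v ∈ L′)

  FinitelyMany : (List V → Set) → Set
  FinitelyMany P = ∃[ Ls ] (∀ L → P L → ∃[ L′ ] (L′ ∈ Ls × SameSet L L′))

module Submission where

-- If L is a mincut crossing K, each of the two components B₁, B₂ of Γ - L that carry the crossing
-- contains ends lying in two different components of Γ - K, so it meets K, say in p ∈ B₁ and q ∈ B₂.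
-- Thus L separates two vertices p, q of K.  Moreover L is a tight p–q separator: if some w ∈ L had
-- no neighbour in the component of p, then L - w would still separate p from q, and since every
-- component of Γ - L has a ray (no slices), L - w would be a smaller end cut.  Finally, for fixed
-- p, q and a size bound t, all tight p–q separators of size ≤ t lie in one finite set: any p–q walk
-- W meets such a separator T in some u, and T - u is tight of size ≤ t - 1 once u is also
-- forbidden, so recursion over the vertices u of W bounds T.  Taking the union over p, q ∈ K with
-- t = |K| gives a finite set containing every mincut crossing K.

open import Defs
open import Level using (0ℓ)
open import Data.Nat using (ℕ; zero; suc; _≤_; _⊔_)
open import Data.Nat.Properties using (≤-trans; ≤-pred; m≤m⊔n; m≤n⊔m; <⇒≱)
open import Data.List using (List; []; _∷_; _++_; length; filter; map; concatMap)
open import Data.List.Relation.Unary.Any as Any using (here; there)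
open import Data.List.Membership.Propositional using (_∈_; _∉_; lose)
open import Data.List.Membership.Propositional.Properties
  using (∈-filter⁺; ∈-filter⁻; ∈-++⁺ˡ; ∈-++⁺ʳ; ∈-map⁺; ∈-concatMap⁺)
open import Data.List.Relation.Binary.Subset.Propositional using (_⊆_)
open import Data.List.Properties using (filter-notAll)
open import Data.List.Relation.Unary.Unique.Propositional using (Unique)
open import Data.List.Relation.Unary.Unique.Propositional.Properties using (filter⁺)
open import Data.Product using (∃; ∃-syntax; _×_; _,_; proj₁; proj₂)
open import Data.Sum using (inj₁; inj₂; [_,_])
open import Data.Empty using (⊥-elim)
open import Relation.Nullary using (¬_; yes; no; ¬?)
open import Relation.Unary as U using (Pred; Decidable; _∪_; ∅; ｛_｝)
open import Relation.Binary.PropositionalEquality using (_≡_; _≢_; refl)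
open import Function.Bundles using (mk⇔)
open import Axiom.ExcludedMiddle using (ExcludedMiddle)

sublists : {A : Set} → List A → List (List A)
sublists []       = [] ∷ []
sublists (x ∷ xs) = map (x ∷_) (sublists xs) ++ sublists xs

filter∈sublists : {A : Set} {P : Pred A 0ℓ} (P? : Decidable P) (xs : List A)
                → filter P? xs ∈ sublists xs
filter∈sublists P? []       = here refl
filter∈sublists P? (x ∷ xs) with P? x
... | yes _ = ∈-++⁺ˡ (∈-map⁺ (x ∷_) (filter∈sublists P? xs))
... | no  _ = ∈-++⁺ʳ (map (x ∷_) (sublists xs)) (filter∈sublists P? xs)

module Walks (Γ : Graph) where
  open Graph Γ

  -- Conn Γ K is Walk (_∈ K); arbitrary forbidden predicates are needed once vertices are forbidden
  -- one at a time.
  data Walk (B : Pred V 0ℓ) : V → V → Set where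
    done : ∀ {x} → ¬ B x → Walk B x x
    edge : ∀ {x y z} → ¬ B x → x ~ y → Walk B y z → Walk B x z

  Conn⇒Walk : ∀ {K x y} → Conn Γ K x y → Walk (_∈ K) x y
  Conn⇒Walk (here x∉K)      = done x∉K
  Conn⇒Walk (step x∉K e xy) = edge x∉K e (Conn⇒Walk xy)

  Walk⇒Conn : ∀ {K x y} → Walk (_∈ K) x y → Conn Γ K x y
  Walk⇒Conn (done x∉K)      = here x∉K
  Walk⇒Conn (edge x∉K e xy) = step x∉K e (Walk⇒Conn xy)

  source-allowed : ∀ {B x y} → Walk B x y → ¬ B x
  source-allowed (done ¬Bx)     = ¬Bx
  source-allowed (edge ¬Bx _ _) = ¬Bx

  target-allowed : ∀ {B x y} → Walk B x y → ¬ B y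
  target-allowed (done ¬By)    = ¬By
  target-allowed (edge _ _ xy) = target-allowed xy

  Walk-mono : ∀ {B B′ x y} → B′ U.⊆ B → Walk B x y → Walk B′ x y
  Walk-mono B′⊆B (done ¬Bx)      = done (λ B′x → ¬Bx (B′⊆B B′x))
  Walk-mono B′⊆B (edge ¬Bx e xy) = edge (λ B′x → ¬Bx (B′⊆B B′x)) e (Walk-mono B′⊆B xy)

  extend : ∀ {B x y z} → Walk B x y → y ~ z → ¬ B z → Walk B x z
  extend (done ¬Bx)      e′ ¬Bz = edge ¬Bx e′ (done ¬Bz)
  extend (edge ¬Bx e xy) e′ ¬Bz = edge ¬Bx e (extend xy e′ ¬Bz)

  Walk-trans : ∀ {B x y z} → Walk B x y → Walk B y z → Walk B x z
  Walk-trans (done _)        yz = yz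
  Walk-trans (edge ¬Bx e xy) yz = edge ¬Bx e (Walk-trans xy yz)

  Walk-sym : ∀ {B x y} → Walk B x y → Walk B y x
  Walk-sym (done ¬Bx)      = done ¬Bx
  Walk-sym (edge ¬Bx e xy) = extend (Walk-sym xy) (~-sym e) ¬Bx

  Walk-preserves : ∀ {B x z} (I : Pred V 0ℓ) → (∀ {u y} → I u → u ~ y → ¬ B y → I y)
                 → I x → Walk B x z → I z
  Walk-preserves I step-I Ix (done _)      = Ix
  Walk-preserves I step-I Ix (edge _ e xy) =
    Walk-preserves I step-I (step-I Ix e (source-allowed xy)) xy

  Conn-sym : ∀ {K x y} → Conn Γ K x y → Conn Γ K y x
  Conn-sym xy = Walk⇒Conn (Walk-sym (Conn⇒Walk xy))

  Conn-anti : ∀ {K K′ x y} → K′ ⊆ K → Conn Γ K x y → Conn Γ K′ x y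
  Conn-anti K′⊆K xy = Walk⇒Conn (Walk-mono K′⊆K (Conn⇒Walk xy))

  CompHasRay-anti : ∀ {K K′ x} → K′ ⊆ K → CompHasRay Γ K x → CompHasRay Γ K′ x
  CompHasRay-anti K′⊆K (r , x⇝r) = r , λ n → Conn-anti K′⊆K (x⇝r n)

  vertices : ∀ {B x y} → Walk B x y → List V
  vertices (done {x} _)     = x ∷ []
  vertices (edge {x} _ _ w) = x ∷ vertices w

module _ (em : ExcludedMiddle 0ℓ) (Γ : Graph) where
  open Graph Γ
  open Walks Γ

  _─_ : List V → V → List V
  T ─ u = filter (λ v → ¬? (em {v ≡ u})) T

  ∈-─⁺ : ∀ {T u v} → v ∈ T → v ≢ u → v ∈ T ─ u
  ∈-─⁺ = ∈-filter⁺ (λ v → ¬? (em {v ≡ _}))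

  ∈-─⁻ : ∀ T {u v} → v ∈ T ─ u → v ∈ T × v ≢ u
  ∈-─⁻ T = ∈-filter⁻ (λ v → ¬? (em {v ≡ _})) {xs = T}

  ─-shorter : ∀ {T u} → u ∈ T → suc (length (T ─ u)) ≤ length T
  ─-shorter {T} {u} u∈T =
    filter-notAll (λ v → ¬? (em {v ≡ u})) T (Any.map (λ { refl u≢u → u≢u refl }) u∈T)

  walk-meets : ∀ {B x y} (C : Pred V 0ℓ) (W : Walk B x y) → ¬ Walk (B ∪ C) x y
             → ∃[ u ] (u ∈ vertices W × C u)
  walk-meets {x = x} C (done ¬Bx) ¬W′ with em {C x}
  ... | yes Cx  = x , here refl , Cx
  ... | no  ¬Cx = ⊥-elim (¬W′ (done [ ¬Bx , ¬Cx ]))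
  walk-meets {x = x} C (edge ¬Bx e W) ¬W′ with em {C x}
  ... | yes Cx  = x , here refl , Cx
  ... | no  ¬Cx with u , u∈W , Cu ← walk-meets C W (λ W′ → ¬W′ (edge [ ¬Bx , ¬Cx ] e W′))
                = u , there u∈W , Cu

  FinitelyMany-⊆ : {P : List V → Set} (S : List V) → (∀ {L} → P L → L ⊆ S) → FinitelyMany Γ P
  FinitelyMany-⊆ S L⊆S = sublists S , λ L PL →
    filter (λ v → em {v ∈ L}) S , filter∈sublists (λ v → em {v ∈ L}) S ,
    λ v → mk⇔ (λ v∈L → ∈-filter⁺ (λ v → em {v ∈ L}) (L⊆S PL v∈L) v∈L)
              (λ v∈S → proj₂ (∈-filter⁻ (λ v → em {v ∈ L}) {xs = S} v∈S))

  module TightSeparators (p q : V) where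

    Separates : Pred V 0ℓ → List V → Set
    Separates R T = ¬ Walk (R ∪ (_∈ T)) p q

    Tight : Pred V 0ℓ → List V → Set
    Tight R T = ∀ {w} → w ∈ T → Walk (R ∪ (_∈ T ─ w)) p q

    separates-─ : ∀ {R T} u → Separates R T → Separates (R ∪ ｛ u ｝) (T ─ u)
    separates-─ {R} {T} u separates W = separates (Walk-mono forbidden W)
      where
      forbidden : R ∪ (_∈ T) U.⊆ (R ∪ ｛ u ｝) ∪ (_∈ T ─ u)
      forbidden (inj₁ Rv) = inj₁ (inj₁ Rv)
      forbidden {v} (inj₂ v∈T) with em {v ≡ u}
      ... | yes refl = inj₁ (inj₂ refl)
      ... | no  v≢u  = inj₂ (∈-─⁺ v∈T v≢u)

    tight-─ : ∀ {R T u} → u ∈ T → Tight R T → Tight (R ∪ ｛ u ｝) (T ─ u)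
    tight-─ {R} {T} {u} u∈T tight {w} w∈T─u = Walk-mono forbidden (tight w∈T)
      where
      w∈T : w ∈ T
      w∈T = proj₁ (∈-─⁻ T w∈T─u)
      forbidden : (R ∪ ｛ u ｝) ∪ (_∈ (T ─ u) ─ w) U.⊆ R ∪ (_∈ T ─ w)
      forbidden (inj₁ (inj₁ Rv))  = inj₁ Rv
      forbidden (inj₁ (inj₂ refl)) = inj₂ (∈-─⁺ u∈T λ { refl → proj₂ (∈-─⁻ T w∈T─u) refl })
      forbidden (inj₂ v∈T─u─w)    = inj₂ (∈-─⁺ (proj₁ (∈-─⁻ T (proj₁ (∈-─⁻ (T ─ u) v∈T─u─w))))
                                               (proj₂ (∈-─⁻ (T ─ u) v∈T─u─w)))

    -- W is any p–q walk avoiding R; every separator meets it.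
    hull : ℕ → Pred V 0ℓ → List V
    hull zero    R = []
    hull (suc t) R with em {Walk R p q}
    ... | no  _ = []
    ... | yes W = vertices W ++ concatMap (λ u → hull t (R ∪ ｛ u ｝)) (vertices W)

    ⊆-hull : ∀ t R {T} → length T ≤ t → Separates R T → Tight R T → T ⊆ hull t R
    ⊆-hull zero    R {_ ∷ _} () _ _
    ⊆-hull (suc t) R {T} |T|≤t separates tight {w} w∈T with em {Walk R p q}
    ... | no ¬W = ⊥-elim (¬W (Walk-mono inj₁ (tight w∈T)))
    ... | yes W with u , u∈W , u∈T ← walk-meets (_∈ T) W separates | em {w ≡ u}
    ...   | yes refl = ∈-++⁺ˡ u∈W
    ...   | no  w≢u  = ∈-++⁺ʳ (vertices W) (∈-concatMap⁺ (λ u → hull t (R ∪ ｛ u ｝)) (lose u∈W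
              (⊆-hull t (R ∪ ｛ u ｝) (≤-pred (≤-trans (─-shorter u∈T) |T|≤t))
                      (separates-─ u separates) (tight-─ u∈T tight) (∈-─⁺ w∈T w≢u))))

    ¬Conn⇒Separates : ∀ {L} → ¬ Conn Γ L p q → Separates ∅ L
    ¬Conn⇒Separates ¬pq W = ¬pq (Walk⇒Conn (Walk-mono inj₂ W))

  open TightSeparators public

  Walk-─⇒Walk : ∀ {L p w y} → p ∉ L → ¬ (∃[ a ] (w ~ a × Walk (_∈ L) p a))
              → Walk (_∈ L ─ w) p y → Walk (_∈ L) p y
  Walk-─⇒Walk {L} {p} {w} p∉L unseen = Walk-preserves (Walk (_∈ L) p) step-off-w (done p∉L)
    where
    step-off-w : ∀ {u y} → Walk (_∈ L) p u → u ~ y → y ∉ L ─ w → Walk (_∈ L) p y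
    step-off-w {u} {y} pu e y∉L─w with em {y ≡ w}
    ... | yes refl = ⊥-elim (unseen (u , ~-sym e , pu))
    ... | no  y≢w  = extend pu e (λ y∈L → y∉L─w (∈-─⁺ y∈L y≢w))

  module _ (noSlices : NoSlices Γ) {L : List V} (mcL : MinCut Γ L) where

    -- Otherwise L ─ w would be a smaller end cut.
    mincut-vertex-sees-component : ∀ {p q w} → p ∉ L → q ∉ L → ¬ Conn Γ L p q → w ∈ L
                                 → ∃[ a ] (w ~ a × Walk (_∈ L) p a)
    mincut-vertex-sees-component {p} {q} {w} p∉L q∉L ¬pq w∈L with em {∃[ a ] (w ~ a × Walk (_∈ L) p a)}
    ... | yes seen   = seen
    ... | no  unseen = ⊥-elim (<⇒≱ (─-shorter w∈L) (minimal (L ─ w) (filter⁺ _ uniqueL) endCut))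
      where
      uniqueL : Unique L
      uniqueL = proj₁ mcL
      minimal : ∀ L′ → Unique L′ → EndCut Γ L′ → length L ≤ length L′
      minimal = proj₂ (proj₂ mcL)
      L─w⊆L : L ─ w ⊆ L
      L─w⊆L v∈L─w = proj₁ (∈-─⁻ L v∈L─w)
      endCut : EndCut Γ (L ─ w)
      endCut = p , q
             , (λ pq → ¬pq (Walk⇒Conn (Walk-─⇒Walk p∉L unseen (Conn⇒Walk pq))))
             , CompHasRay-anti L─w⊆L (noSlices L mcL p p∉L)
             , CompHasRay-anti L─w⊆L (noSlices L mcL q q∉L)

    mincut-tight : ∀ {p q} → p ∉ L → q ∉ L → ¬ Conn Γ L p q → Tight p q ∅ L
    mincut-tight {p} {q} p∉L q∉L ¬pq {w} w∈L
      with _ , wa , pa ← mincut-vertex-sees-component p∉L q∉L ¬pq w∈L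
         | _ , wb , qb ← mincut-vertex-sees-component q∉L p∉L (λ qp → ¬pq (Conn-sym qp)) w∈L
      = Walk-trans (extend (Walk-mono off-L pa) (~-sym wa) w-allowed)
                   (edge w-allowed wb (Walk-mono off-L (Walk-sym qb)))
      where
      off-L : ∅ ∪ (_∈ L ─ w) U.⊆ (_∈ L)
      off-L (inj₂ v∈L─w) = proj₁ (∈-─⁻ L v∈L─w)
      w-allowed : ¬ (∅ ∪ (_∈ L ─ w)) w
      w-allowed (inj₂ w∈L─w) = proj₂ (∈-─⁻ L w∈L─w) refl

  EndIn-meet : ∀ {K L x y r} → EndIn Γ K x r → EndIn Γ L y r → ∃[ v ] (Conn Γ K x v × Conn Γ L y v)
  EndIn-meet (N , x⇝r) (M , y⇝r) = _ , x⇝r (N ⊔ M) (m≤m⊔n N M) , y⇝r (N ⊔ M) (m≤n⊔m N M)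

  component-avoiding : ∀ {K L y a b} → ¬ (∃[ k ] (k ∈ K × Walk (_∈ L) y k))
                     → Walk (_∈ L) y a → Walk (_∈ L) a b → Walk (_∈ K) a b
  component-avoiding misses ya (done _)      = done (λ a∈K → misses (_ , a∈K , ya))
  component-avoiding misses ya (edge _ e ab) =
    edge (λ a∈K → misses (_ , a∈K , ya)) e
         (component-avoiding misses (extend ya e (source-allowed ab)) ab)

  component-meets-cut : ∀ {K L x₁ x₂ y r r′} → ¬ Conn Γ K x₁ x₂
                      → EndIn Γ K x₁ r → EndIn Γ L y r → EndIn Γ K x₂ r′ → EndIn Γ L y r′
                      → ∃[ k ] (k ∈ K × Walk (_∈ L) y k)
  component-meets-cut {K} {L} {x₁} {x₂} {y} {r} {r′} ¬x₁x₂ x₁⇝r y⇝r x₂⇝r′ y⇝r′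
    with em {∃[ k ] (k ∈ K × Walk (_∈ L) y k)}
  ... | yes meets  = meets
  ... | no  misses
    with v , x₁v , yv ← EndIn-meet {r = r} x₁⇝r y⇝r | v′ , x₂v′ , yv′ ← EndIn-meet {r = r′} x₂⇝r′ y⇝r′
    = ⊥-elim (¬x₁x₂ (Walk⇒Conn x₁x₂))
    where
    vv′ : Walk (_∈ K) v v′
    vv′ = component-avoiding misses (Conn⇒Walk yv)
                             (Walk-trans (Walk-sym (Conn⇒Walk yv)) (Conn⇒Walk yv′))
    x₁x₂ : Walk (_∈ K) x₁ x₂
    x₁x₂ = Walk-trans (Conn⇒Walk x₁v) (Walk-trans vv′ (Walk-sym (Conn⇒Walk x₂v′)))

  crossing-mincut-tight-separator : NoSlices Γ → ∀ {K L} → MinCut Γ K → MinCut Γ L → Cross Γ K L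
    → ∃[ p ] ∃[ q ] (p ∈ K × q ∈ K × length L ≤ length K × Separates p q ∅ L × Tight p q ∅ L)
  crossing-mincut-tight-separator noSlices {K} {L} mcK mcL
    ( _ , _ , _ , _ , ¬x₁x₂ , ¬y₁y₂
    , (r₁₁ , x₁r₁₁ , y₁r₁₁) , (r₁₂ , x₁r₁₂ , y₂r₁₂) , (r₂₁ , x₂r₂₁ , y₁r₂₁) , (r₂₂ , x₂r₂₂ , y₂r₂₂))
    with p , p∈K , y₁p ← component-meets-cut {r = r₁₁} {r₂₁} ¬x₁x₂ x₁r₁₁ y₁r₁₁ x₂r₂₁ y₁r₂₁
       | q , q∈K , y₂q ← component-meets-cut {r = r₁₂} {r₂₂} ¬x₁x₂ x₁r₁₂ y₂r₁₂ x₂r₂₂ y₂r₂₂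
    = p , q , p∈K , q∈K , proj₂ (proj₂ mcL) K (proj₁ mcK) (proj₁ (proj₂ mcK))
    , ¬Conn⇒Separates p q ¬pq , mincut-tight noSlices mcL (target-allowed y₁p) (target-allowed y₂q) ¬pq
    where
    ¬pq : ¬ Conn Γ L p q
    ¬pq pq = ¬y₁y₂ (Walk⇒Conn (Walk-trans y₁p (Walk-trans (Conn⇒Walk pq) (Walk-sym y₂q))))

mainTheorem15 : ExcludedMiddle 0ℓ → (Γ : Graph) → Connected Γ
    → ∃ (EndCut Γ) → NoSlices Γ
    → (K : List (Graph.V Γ)) → MinCut Γ K
    → FinitelyMany Γ (λ L → MinCut Γ L × Cross Γ K L)
mainTheorem15 em Γ _ _ noSlices K mcK = FinitelyMany-⊆ em Γ candidates crossing⊆candidates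
  where
  candidates : List (Graph.V Γ)
  candidates = concatMap (λ p → concatMap (λ q → hull em Γ p q (length K) ∅) K) K
  crossing⊆candidates : ∀ {L} → MinCut Γ L × Cross Γ K L → L ⊆ candidates
  crossing⊆candidates (mcL , cross) v∈L
    with p , q , p∈K , q∈K , |L|≤|K| , separates , tight
           ← crossing-mincut-tight-separator em Γ noSlices mcK mcL cross
    = ∈-concatMap⁺ _ (lose p∈K (∈-concatMap⁺ _ (lose q∈K
        (⊆-hull em Γ p q (length K) ∅ |L|≤|K| separates tight v∈L))))
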